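{- Let $k_1,\dots,k_n\ge1$ be integers, $\mathbf{k}=(k_1,\dots,k_n)$, and $A=M_{k_1}\times\dots\times M_{k_n}$, with atoms $a_1,\dots,a_n$ ($a_i$ has $\frac1{k_i}$ in the $i$-th coordinate and $0$ elsewhere). Let $S_{\mathbf{k}}$ be the MV-algebra defined in the context, and write $x_i$ also for the image of the generator $x_i$ in $S_{\mathbf{k}}$. Then there is exactly one state $\upsilon_A\colon A\to S_{\mathbf{k}}$ with $\upsilon_A(a_i)=x_i$ for $i=1,\dots,n$. Moreover, $\upsilon_A$ is the universal state of $A$: for every MV-algebra $N$ and every state $s\colon A\to N$ there is exactly one MV-algebra homomorphism $h\colon S_{\mathbf{k}}\to N$ with $h\circ\upsilon_A=s$.
   Context: For an integer $k\ge1$, $M_k=\{0,\frac1k,\dots,1\}$ is the finite totally ordered MV-algebra (a subalgebra of $[0,1]$ with $x\oplus y=\min(x+y,1)$, $\neg x=1-x$). For an MV-algebra $N$, $\Xi N$ is its unital Abelian $\ell$-group under Mundici's equivalence, with $N$ identified with the unit interval of $\Xi N$. In an MV-algebra, $a\odot b=\neg(\neg a\oplus\neg b)$ and $1=\neg0$. A state $s\colon A\to N$ is a map with $s(1)=1$ and $s(a\oplus b)=s(a)+s(b)$ (in $\Xi N$) whenever $a\odot b=0$. Let $Fn$ be the free MV-algebra on generators $x_1,\dots,x_n$. There is an MV-term $\sigma(x_1,\dots,x_n)$ such that, for every MV-algebra $N$ and all $b_1,\dots,b_n\in N$, $\sigma(b_1,\dots,b_n)=0$ holds in $N$ if and only if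 $\sum_{i=1}^nk_ib_i=1$ holds in $\Xi N$. Let $U(\mathbf{k})$ be the ideal of $Fn$ generated by $\sigma(x_1,\dots,x_n)$. Define $S_{\mathbf{k}}=Fn/U(\mathbf{k})$; this is the MV-algebra presented by generators $x_1,\dots,x_n$ and the relation $\sum_i k_ix_i=1$. -}

module Defs where

open import Level using (Level; _⊔_; Setω) renaming (suc to lsuc; zero to lzero)
open import Data.Nat using (ℕ; zero; suc; _+_; _⊓_; _≤_; s≤s; z≤n)
open import Data.Nat.Properties using (m⊓n≤n)
open import Data.Fin using (Fin; toℕ; fromℕ<; opposite; _≟_)
  renaming (zero to fzero; suc to fsuc)
open import Data.Product using (_×_; _,_)
open import Data.Empty using (⊥)
open import Data.List using (List; []; _∷_; replicate; foldl; foldr; concatMap)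
open import Data.List.Base using (allFin)
open import Relation.Binary using (Rel; IsEquivalence)
open import Relation.Binary.PropositionalEquality as P using (_≡_)
open import Relation.Nullary.Decidable using (yes; no)
open import Algebra.Definitions using (Congruent₁; Congruent₂; Associative; Commutative; RightIdentity)

-- MV-algebras (Chang's axioms, in the equational form of
-- Cignoli–D'Ottaviano–Mundici), over a setoid.

record MVSig c ℓ : Set (lsuc (c ⊔ ℓ)) where
  infixr 7 ¬_
  infixl 6 _⊕_ _⊙_
  infix 4 _≈_
  field
    Carrier       : Set c
    _≈_           : Rel Carrier ℓ
    _⊕_           : Carrier → Carrier → Carrier
    ¬_            : Carrier → Carrier
    𝟘             : Carrier
    isEquivalence : IsEquivalence _≈_

  𝟙 : Carrier
  𝟙 = ¬ 𝟘

  _⊙_ : Carrier → Carrier → Carrier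
  x ⊙ y = ¬ (¬ x ⊕ ¬ y)

record MVAlgebra c ℓ : Set (lsuc (c ⊔ ℓ)) where
  field
    sig : MVSig c ℓ
  open MVSig sig public
  field
    ⊕-cong      : Congruent₂ _≈_ _⊕_
    ¬-cong      : Congruent₁ _≈_ ¬_
    ⊕-assoc     : Associative _≈_ _⊕_
    ⊕-comm      : Commutative _≈_ _⊕_
    ⊕-identityʳ : RightIdentity _≈_ 𝟘 _⊕_
    ¬¬          : ∀ x → ¬ ¬ x ≈ x
    ⊕-absorb    : ∀ x → x ⊕ ¬ 𝟘 ≈ ¬ 𝟘
    łuk         : ∀ x y → ¬ (¬ x ⊕ y) ⊕ y ≈ ¬ (¬ y ⊕ x) ⊕ x

-- Addition in ΞN restricted to the unit interval.
-- Under Mundici's equivalence an element x of N is the good sequence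
-- (x,0,0,…) of ΞN, and (x) + (y) = (x ⊕ y, x ⊙ y, 0, …).  Hence, for
-- x y z ∈ N, the equation  z = x + y  holds in ΞN  iff
-- x ⊙ y = 0  and  z = x ⊕ y.
SumIs : ∀ {c ℓ} (N : MVAlgebra c ℓ) → let open MVAlgebra N in
        Carrier → Carrier → Carrier → Set ℓ
SumIs N x y z = (x ⊙ y ≈ 𝟘) × (z ≈ x ⊕ y)
  where open MVAlgebra N

record State {a ℓa c ℓ} (A : MVSig a ℓa) (N : MVAlgebra c ℓ)
       : Set (a ⊔ ℓa ⊔ c ⊔ ℓ) where
  private
    module A = MVSig A
    module N = MVAlgebra N
  field
    map      : A.Carrier → N.Carrier
    map-cong : ∀ {x y} → x A.≈ y → map x N.≈ map y
    map-𝟙    : map A.𝟙 N.≈ N.𝟙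
    additive : ∀ x y → x A.⊙ y A.≈ A.𝟘 →
               SumIs N (map x) (map y) (map (x A.⊕ y))

record Hom {a ℓa c ℓ} (M : MVAlgebra a ℓa) (N : MVAlgebra c ℓ)
       : Set (a ⊔ ℓa ⊔ c ⊔ ℓ) where
  private
    module M = MVAlgebra M
    module N = MVAlgebra N
  field
    map      : M.Carrier → N.Carrier
    map-cong : ∀ {x y} → x M.≈ y → map x N.≈ map y
    map-⊕    : ∀ x y → map (x M.⊕ y) N.≈ map x N.⊕ map y
    map-¬    : ∀ x → map (M.¬ x) N.≈ N.¬ map x
    map-𝟘    : map M.𝟘 N.≈ N.𝟘

infixl 6 _⊕ₜ_ _⊙ₜ_
infixr 7 ¬ₜ_

data Term (n : ℕ) : Set where
  var  : Fin n → Term n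
  𝟘ₜ   : Term n
  _⊕ₜ_ : Term n → Term n → Term n
  ¬ₜ_  : Term n → Term n

_⊙ₜ_ : ∀ {n} → Term n → Term n → Term n
x ⊙ₜ y = ¬ₜ (¬ₜ x ⊕ₜ ¬ₜ y)

infix 4 _⊢_≈ₜ_

data _⊢_≈ₜ_ {n} (R : Term n → Term n → Set) : Term n → Term n → Set where
  rel     : ∀ {s t} → R s t → R ⊢ s ≈ₜ t
  refl    : ∀ {s} → R ⊢ s ≈ₜ s
  sym     : ∀ {s t} → R ⊢ s ≈ₜ t → R ⊢ t ≈ₜ s
  trans   : ∀ {s t u} → R ⊢ s ≈ₜ t → R ⊢ t ≈ₜ u → R ⊢ s ≈ₜ u
  ⊕-cong  : ∀ {s s′ t t′} → R ⊢ s ≈ₜ s′ → R ⊢ t ≈ₜ t′ → R ⊢ s ⊕ₜ t ≈ₜ s′ ⊕ₜ t′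
  ¬-cong  : ∀ {s s′} → R ⊢ s ≈ₜ s′ → R ⊢ ¬ₜ s ≈ₜ ¬ₜ s′
  assoc   : ∀ x y z → R ⊢ (x ⊕ₜ y) ⊕ₜ z ≈ₜ x ⊕ₜ (y ⊕ₜ z)
  comm    : ∀ x y → R ⊢ x ⊕ₜ y ≈ₜ y ⊕ₜ x
  idʳ     : ∀ x → R ⊢ x ⊕ₜ 𝟘ₜ ≈ₜ x
  ¬¬      : ∀ x → R ⊢ ¬ₜ ¬ₜ x ≈ₜ x
  absorb  : ∀ x → R ⊢ x ⊕ₜ ¬ₜ 𝟘ₜ ≈ₜ ¬ₜ 𝟘ₜ
  łuk     : ∀ x y → R ⊢ ¬ₜ (¬ₜ x ⊕ₜ y) ⊕ₜ y ≈ₜ ¬ₜ (¬ₜ y ⊕ₜ x) ⊕ₜ x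

Presented : (n : ℕ) → (Term n → Term n → Set) → MVAlgebra lzero lzero
Presented n R = record
  { sig = record
    { Carrier = Term n
    ; _≈_ = R ⊢_≈ₜ_
    ; _⊕_ = _⊕ₜ_
    ; ¬_ = ¬ₜ_
    ; 𝟘 = 𝟘ₜ
    ; isEquivalence = record { refl = refl ; sym = sym ; trans = trans }
    }
  ; ⊕-cong = ⊕-cong
  ; ¬-cong = ¬-cong
  ; ⊕-assoc = assoc
  ; ⊕-comm = comm
  ; ⊕-identityʳ = idʳ
  ; ¬¬ = ¬¬
  ; ⊕-absorb = absorb
  ; łuk = łuk
  }

NoRel : ∀ {n} → Term n → Term n → Set
NoRel _ _ = ⊥

F : ℕ → MVAlgebra lzero lzero
F n = Presented n NoRel

-- The term σ(x₁,…,xₙ) expressing  Σᵢ kᵢ xᵢ = 1  (in ΞN).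
-- Let c₁,…,c_m be the list x₁ (k₁ times), …, xₙ (kₙ times), and
-- pⱼ = c₁ ⊕ … ⊕ cⱼ (p₀ = 0).  Then c₁ + … + c_m = 1 in ΞN iff
-- p_m = 1 and cⱼ ⊙ pⱼ₋₁ = 0 for all j, iff
--   σ = ¬ p_m ⊕ ⨁ⱼ (cⱼ ⊙ pⱼ₋₁) = 0.

summands : (n : ℕ) → (Fin n → ℕ) → List (Term n)
summands n k = concatMap (λ i → replicate (k i) (var i)) (allFin n)

⨁ₜ : ∀ {n} → List (Term n) → Term n
⨁ₜ = foldl _⊕ₜ_ 𝟘ₜ

overlaps : ∀ {n} → Term n → List (Term n) → Term n
overlaps p []       = 𝟘ₜ
overlaps p (c ∷ cs) = (c ⊙ₜ p) ⊕ₜ overlaps (p ⊕ₜ c) cs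

σ : (n : ℕ) → (Fin n → ℕ) → Term n
σ n k = ¬ₜ (⨁ₜ (summands n k)) ⊕ₜ overlaps 𝟘ₜ (summands n k)

-- The relation  σ = 0 .  The congruence it generates (together with
-- the MV-axioms) is the one associated with the ideal U(k) of Fn
-- generated by σ, so the algebra presented below is Fn / U(k).
data σRel (n : ℕ) (k : Fin n → ℕ) : Term n → Term n → Set where
  σ≈0 : σRel n k (σ n k) 𝟘ₜ

S : (n : ℕ) → (Fin n → ℕ) → MVAlgebra lzero lzero
S n k = Presented n (σRel n k)

-- The finite chains M_k = {0, 1/k, …, 1}, element j/k represented by
-- j : Fin (suc k);  x ⊕ y = min(x + y, 1),  ¬ x = 1 - x.

_⊕ₘ_ : ∀ {k} → Fin (suc k) → Fin (suc k) → Fin (suc k)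
_⊕ₘ_ {k} x y = fromℕ< (s≤s (m⊓n≤n (toℕ x + toℕ y) k))

A : (n : ℕ) → (Fin n → ℕ) → MVSig lzero lzero
A n k = record
  { Carrier = (i : Fin n) → Fin (suc (k i))
  ; _≈_ = λ x y → ∀ i → x i ≡ y i
  ; _⊕_ = λ x y i → x i ⊕ₘ y i
  ; ¬_ = λ x i → opposite (x i)
  ; 𝟘 = λ _ → fzero
  ; isEquivalence = record
    { refl = λ _ → P.refl
    ; sym = λ p i → P.sym (p i)
    ; trans = λ p q i → P.trans (p i) (q i)
    }
  }

atom : (n : ℕ) (k : Fin n → ℕ) → (∀ i → 1 ≤ k i) → Fin n → MVSig.Carrier (A n k)
atom n k hk i j with j ≟ i
... | yes _ = fromℕ< (s≤s (hk j))
... | no _  = fzero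

record Σω {a} (X : Set a) (B : X → Setω) : Setω where
  constructor _,ω_
  field
    fst : X
    snd : B fst

record _×ω_ {a} (X : Set a) (B : Setω) : Setω where
  constructor _,ω_
  field
    fst : X
    snd : B

-- Summability of a list (existence of its sum in ΞM) is invariant under permutation,
-- because orthogonality is associative (⊥-assoc). The relation σ = 0 says exactly that
-- the list in which xᵢ occurs kᵢ times is a partition of unity. Every a ∈ A is the
-- orthogonal sum of the atoms, aᵢ taken ⌊ a ⌋ᵢ = kᵢ·a(i) times, so a state s is
-- determined by the values s(aᵢ), and these satisfy σ = 0. Hence a ↦ Σᵢ ⌊ a ⌋ᵢ xᵢ is a
-- state, since disjoint sub-multisets of a partition of unity are orthogonal. It is the
-- only state with aᵢ ↦ xᵢ, and xᵢ ↦ s(aᵢ) induces the unique homomorphism S → N that s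
-- factors through.

module Submission where

open import Level using (Level; _⊔_)
open import Function using (_∘_; id; _⇔_; mk⇔; Equivalence)
open import Relation.Nullary using (yes; no; contradiction)
open import Relation.Binary using (Rel; Setoid)
open import Relation.Binary.PropositionalEquality as ≡ using (_≡_; _≢_; _≗_; cong; cong₂)
import Relation.Binary.Reasoning.Setoid as SetoidReasoning
open import Algebra.Structures using (IsCommutativeMonoid)

open import Data.Product using (Σ; ∃-syntax; _×_; _,_; proj₁; proj₂)
open import Data.Nat using (ℕ; zero; suc; _+_; _*_; _∸_; _⊓_; _≤_; z≤n; s≤s)
open import Data.Nat.Properties
  using ( +-identityʳ; *-zeroʳ; *-identityʳ; ≤-refl; ≤-trans; +-monoˡ-≤; +-monoʳ-≤
        ; +-cancelˡ-≤; +-cancelʳ-≤; m⊓n≤m; ⊓-glb; m+n≤o⇒n≤o; m≤n⇒m⊓n≡m; m+[n∸m]≡n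
        ; m∸n≡0⇒m≤n; m≤n⇒m∸n≡0; m∸n+n≡m; +-commutativeSemigroup )
open import Algebra.Properties.CommutativeSemigroup +-commutativeSemigroup using (interchange)
open import Data.Nat.ListAction using (sum)
open import Data.Nat.ListAction.Properties using (sum-++)
open import Data.Fin using (Fin; toℕ; opposite; _≟_) renaming (zero to fzero; suc to fsuc)
import Data.Fin.Properties as Fin
open import Data.Fin.Properties using (toℕ-fromℕ<; toℕ-injective; opposite-prop; toℕ≤pred[n])

open import Data.List
  using (List; []; _∷_; _++_; foldr; foldl; map; concatMap; replicate; tabulate; allFin)
open import Data.List.Properties
  using (map-∘; map-++; map-replicate; map-tabulate; map-concatMap; concatMap-cong; ++-assoc)
open import Data.List.Relation.Binary.Permutation.Propositional
  using (_↭_; ↭⇒↭ₛ′; ↭-reflexive; module PermutationReasoning)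
import Data.List.Relation.Binary.Permutation.Propositional as ↭
open import Data.List.Relation.Binary.Permutation.Propositional.Properties using (++⁺ˡ; shifts; map⁺)
import Data.List.Relation.Binary.Permutation.Setoid.Properties as SetoidPermutation

open import Defs hiding (refl; sym; trans; ⊕-cong; ¬-cong; assoc; comm; idʳ; ¬¬; absorb; łuk)
import Defs as ≈ₜ

-- Multisets of indices

replicate-+ : ∀ {a} {X : Set a} m n (x : X) → replicate (m + n) x ≡ replicate m x ++ replicate n x
replicate-+ zero    n x = ≡.refl
replicate-+ (suc m) n x = cong (x ∷_) (replicate-+ m n x)

sum-replicate : ∀ m n → sum (replicate m n) ≡ m * n
sum-replicate zero    n = ≡.refl
sum-replicate (suc m) n = cong (n +_) (sum-replicate m n)

sum-tabulate-zero : ∀ {n} (h : Fin n → ℕ) → (∀ j → h j ≡ 0) → sum (tabulate h) ≡ 0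
sum-tabulate-zero {zero}  h h≡0 = ≡.refl
sum-tabulate-zero {suc n} h h≡0 = cong₂ _+_ (h≡0 fzero) (sum-tabulate-zero (h ∘ fsuc) (h≡0 ∘ fsuc))

sum-tabulate-single : ∀ {n} (h : Fin n → ℕ) i → (∀ j → j ≢ i → h j ≡ 0) →
                      sum (tabulate h) ≡ h i
sum-tabulate-single h fzero h≡0 =
  ≡.trans (cong (h fzero +_) (sum-tabulate-zero (h ∘ fsuc) (λ j → h≡0 (fsuc j) λ ())))
          (+-identityʳ (h fzero))
sum-tabulate-single h (fsuc i) h≡0 =
  cong₂ _+_ (h≡0 fzero λ ())
            (sum-tabulate-single (h ∘ fsuc) i (λ j j≢i → h≡0 (fsuc j) (j≢i ∘ Fin.suc-injective)))

multiset : ∀ {n} → (Fin n → ℕ) → List (Fin n)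
multiset {n} c = concatMap (λ i → replicate (c i) i) (allFin n)

copies : ∀ {a} {X : Set a} {n} → (Fin n → X) → (Fin n → ℕ) → List X
copies f c = map f (multiset c)

multiset-cong : ∀ {n} {c d : Fin n → ℕ} → c ≗ d → multiset c ≡ multiset d
multiset-cong {n} c≗d = concatMap-cong (λ i → cong (λ m → replicate m i) (c≗d i)) (allFin n)

copies-concatMap : ∀ {a} {X : Set a} {n} (f : Fin n → X) (c : Fin n → ℕ) →
               copies f c ≡ concatMap (λ i → replicate (c i) (f i)) (allFin n)
copies-concatMap {n = n} f c = ≡.trans (map-concatMap f _ (allFin n))
                                   (concatMap-cong (λ i → map-replicate f (c i) i) (allFin n))

multiset-+ : ∀ {n} (c d : Fin n → ℕ) → multiset (λ i → c i + d i) ↭ multiset c ++ multiset d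
multiset-+ {n} c d = go (allFin n)
  where
  open PermutationReasoning
  rep : (Fin n → ℕ) → Fin n → List (Fin n)
  rep e i = replicate (e i) i

  go : ∀ is → concatMap (rep (λ i → c i + d i)) is ↭ concatMap (rep c) is ++ concatMap (rep d) is
  go []       = ↭.refl
  go (i ∷ is) = begin
    rep (λ i → c i + d i) i ++ concatMap (rep (λ i → c i + d i)) is
      ≡⟨ cong (_++ _) (replicate-+ (c i) (d i) i) ⟩
    (rep c i ++ rep d i) ++ concatMap (rep (λ i → c i + d i)) is
      ↭⟨ ++⁺ˡ (rep c i ++ rep d i) (go is) ⟩
    (rep c i ++ rep d i) ++ (C ++ D)
      ≡⟨ ++-assoc (rep c i) (rep d i) (C ++ D) ⟩
    rep c i ++ (rep d i ++ (C ++ D))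
      ↭⟨ ++⁺ˡ (rep c i) (shifts (rep d i) C) ⟩
    rep c i ++ (C ++ (rep d i ++ D))
      ≡⟨ ++-assoc (rep c i) C (rep d i ++ D) ⟨
    (rep c i ++ C) ++ (rep d i ++ D)
      ∎
    where
    C D : List (Fin n)
    C = concatMap (rep c) is
    D = concatMap (rep d) is

copies-+ : ∀ {a} {X : Set a} {n} (f : Fin n → X) (c d : Fin n → ℕ) →
                 copies f (λ i → c i + d i) ↭ copies f c ++ copies f d
copies-+ f c d = ↭.trans (map⁺ f (multiset-+ c d)) (↭-reflexive (map-++ f (multiset c) (multiset d)))

multiset-single : ∀ {n} (c : Fin n → ℕ) i → (∀ j → j ≢ i → c j ≡ 0) →
                  multiset c ≡ replicate (c i) i
multiset-single {n} c i c≡0 = ≡.trans (go (allFin n)) (cong (λ m → replicate m i) Σc≡ci)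
  where
  Σc≡ci : sum (map c (allFin n)) ≡ c i
  Σc≡ci = ≡.trans (cong sum (map-tabulate id c)) (sum-tabulate-single c i c≡0)

  rep-at-i : ∀ j → replicate (c j) j ≡ replicate (c j) i
  rep-at-i j with j ≟ i
  ... | yes ≡.refl = ≡.refl
  ... | no j≢i rewrite c≡0 j j≢i = ≡.refl

  go : ∀ js → concatMap (λ j → replicate (c j) j) js ≡ replicate (sum (map c js)) i
  go []       = ≡.refl
  go (j ∷ js) = ≡.trans (cong₂ _++_ (rep-at-i j) (go js)) (≡.sym (replicate-+ (c j) _ i))

sum-copies : ∀ {n} (g c : Fin n → ℕ) → sum (copies g c) ≡ sum (tabulate (λ i → c i * g i))
sum-copies {n} g c = ≡.trans (go (allFin n)) (cong sum (map-tabulate id (λ i → c i * g i)))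
  where
  open ≡.≡-Reasoning
  go : ∀ is → sum (map g (concatMap (λ i → replicate (c i) i) is)) ≡ sum (map (λ i → c i * g i) is)
  go []       = ≡.refl
  go (i ∷ is) = begin
    sum (map g (replicate (c i) i ++ rest))           ≡⟨ cong sum (map-++ g (replicate (c i) i) rest) ⟩
    sum (map g (replicate (c i) i) ++ map g rest)     ≡⟨ sum-++ (map g (replicate (c i) i)) (map g rest) ⟩
    sum (map g (replicate (c i) i)) + sum (map g rest) ≡⟨ cong₂ _+_ Σrep (go is) ⟩
    c i * g i + sum (map (λ i → c i * g i) is)        ∎
    where
    rest : List (Fin n)
    rest = concatMap (λ i → replicate (c i) i) is
    Σrep : sum (map g (replicate (c i) i)) ≡ c i * g i
    Σrep = ≡.trans (cong sum (map-replicate g (c i) i)) (sum-replicate (c i) (g i))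

-- The chains M_k

≤-complement : ∀ {k u v} → u + v ≡ k + k → (k ≤ u ⇔ v ≤ k)
≤-complement {k} {u} {v} u+v≡k+k = mk⇔
  (λ k≤u → +-cancelˡ-≤ k v k (≡.subst (k + v ≤_) u+v≡k+k (+-monoˡ-≤ v k≤u)))
  (λ v≤k → +-cancelʳ-≤ k k u (≡.subst (_≤ u + k) u+v≡k+k (+-monoʳ-≤ u v≤k)))

module _ {k : ℕ} where

  toℕ-⊕ₘ : (x y : Fin (suc k)) → toℕ (x ⊕ₘ y) ≡ (toℕ x + toℕ y) ⊓ k
  toℕ-⊕ₘ x y = toℕ-fromℕ< _

  toℕ-⊕ₘ-≤ : (x y : Fin (suc k)) → toℕ x + toℕ y ≤ k → toℕ (x ⊕ₘ y) ≡ toℕ x + toℕ y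
  toℕ-⊕ₘ-≤ x y x+y≤k = ≡.trans (toℕ-⊕ₘ x y) (m≤n⇒m⊓n≡m x+y≤k)

  toℕ-opposite+toℕ : (x : Fin (suc k)) → toℕ (opposite x) + toℕ x ≡ k
  toℕ-opposite+toℕ x = ≡.trans (cong (_+ toℕ x) (opposite-prop x)) (m∸n+n≡m (toℕ≤pred[n] x))

  opposite≡0⇔ : (z : Fin (suc k)) → opposite z ≡ fzero ⇔ k ≤ toℕ z
  opposite≡0⇔ z = mk⇔
    (λ e → m∸n≡0⇒m≤n (≡.trans (≡.sym (opposite-prop z)) (cong toℕ e)))
    (λ k≤z → toℕ-injective (≡.trans (opposite-prop z) (m≤n⇒m∸n≡0 k≤z)))

  -- The left side is x ⊙ y = 0 in M_k, the right side is x + y ≤ 1.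
  ⊙ₘ≡0⇔ : (x y : Fin (suc k)) →
          opposite (opposite x ⊕ₘ opposite y) ≡ fzero ⇔ toℕ x + toℕ y ≤ k
  ⊙ₘ≡0⇔ x y = mk⇔
    (λ e → Equivalence.to ¬x+¬y≥k⇔
             (≤-trans (≡.subst (k ≤_) (toℕ-⊕ₘ ¬x ¬y) (Equivalence.to (opposite≡0⇔ _) e)) (m⊓n≤m _ k)))
    (λ x+y≤k → Equivalence.from (opposite≡0⇔ _)
                 (≡.subst (k ≤_) (≡.sym (toℕ-⊕ₘ ¬x ¬y))
                          (⊓-glb (Equivalence.from ¬x+¬y≥k⇔ x+y≤k) ≤-refl)))
    where
    ¬x ¬y : Fin (suc k)
    ¬x = opposite x
    ¬y = opposite y
    ¬x+¬y≥k⇔ : k ≤ toℕ ¬x + toℕ ¬y ⇔ toℕ x + toℕ y ≤ k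
    ¬x+¬y≥k⇔ = ≤-complement (≡.trans (interchange (toℕ ¬x) (toℕ ¬y) (toℕ x) (toℕ y))
                                     (cong₂ _+_ (toℕ-opposite+toℕ x) (toℕ-opposite+toℕ y)))

-- Orthogonality and finite sums in MV-algebras

module FiniteSums {c ℓ} (M : MVSig c ℓ) where
  open MVSig M public

  infix 4 _⊥_

  _⊥_ : Rel Carrier ℓ
  x ⊥ y = x ⊙ y ≈ 𝟘

  ⨁ : List Carrier → Carrier
  ⨁ = foldr _⊕_ 𝟘

  -- x₁ ∷ … ∷ xₘ is Summable when x₁ + … + xₘ exists in the unit interval of ΞM.
  data Summable : List Carrier → Set (c ⊔ ℓ) where
    []  : Summable []
    _∷_ : ∀ {x xs} → x ⊥ ⨁ xs → Summable xs → Summable (x ∷ xs)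

  PartitionOfUnity : List Carrier → Set (c ⊔ ℓ)
  PartitionOfUnity xs = Summable xs × ⨁ xs ≈ 𝟙

module MVProperties {c ℓ} (M : MVAlgebra c ℓ) where
  open MVAlgebra M public
  open FiniteSums sig public using (_⊥_; ⨁; Summable; []; _∷_; PartitionOfUnity)

  setoid : Setoid c ℓ
  setoid = record { isEquivalence = isEquivalence }

  open Setoid setoid public using ()
    renaming (refl to ≈-refl; sym to ≈-sym; trans to ≈-trans; reflexive to ≈-reflexive)
  open SetoidReasoning setoid

  ⊕-congˡ : ∀ {x y z} → y ≈ z → x ⊕ y ≈ x ⊕ z
  ⊕-congˡ p = ⊕-cong ≈-refl p

  ⊕-congʳ : ∀ {x y z} → y ≈ z → y ⊕ x ≈ z ⊕ x
  ⊕-congʳ p = ⊕-cong p ≈-refl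

  ⊕-identityˡ : ∀ x → 𝟘 ⊕ x ≈ x
  ⊕-identityˡ x = ≈-trans (⊕-comm 𝟘 x) (⊕-identityʳ x)

  ⊕-absorbˡ : ∀ x → 𝟙 ⊕ x ≈ 𝟙
  ⊕-absorbˡ x = ≈-trans (⊕-comm 𝟙 x) (⊕-absorb x)

  ¬𝟙≈𝟘 : ¬ 𝟙 ≈ 𝟘
  ¬𝟙≈𝟘 = ¬¬ 𝟘

  ¬x⊕x≈𝟙 : ∀ x → ¬ x ⊕ x ≈ 𝟙
  ¬x⊕x≈𝟙 x = begin
    ¬ x ⊕ x           ≈⟨ ⊕-congʳ (¬-cong (≈-sym (⊕-identityˡ x))) ⟩
    ¬ (𝟘 ⊕ x) ⊕ x     ≈⟨ ⊕-congʳ (¬-cong (⊕-congʳ (≈-sym ¬𝟙≈𝟘))) ⟩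
    ¬ (¬ 𝟙 ⊕ x) ⊕ x   ≈⟨ łuk x 𝟙 ⟨
    ¬ (¬ x ⊕ 𝟙) ⊕ 𝟙   ≈⟨ ⊕-absorb _ ⟩
    𝟙                 ∎

  x⊕¬x≈𝟙 : ∀ x → x ⊕ ¬ x ≈ 𝟙
  x⊕¬x≈𝟙 x = ≈-trans (⊕-comm x (¬ x)) (¬x⊕x≈𝟙 x)

  ¬x⊕[x⊕y]≈𝟙 : ∀ x y → ¬ x ⊕ (x ⊕ y) ≈ 𝟙
  ¬x⊕[x⊕y]≈𝟙 x y = begin
    ¬ x ⊕ (x ⊕ y)  ≈⟨ ⊕-assoc _ _ _ ⟨
    (¬ x ⊕ x) ⊕ y  ≈⟨ ⊕-congʳ (¬x⊕x≈𝟙 x) ⟩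
    𝟙 ⊕ y          ≈⟨ ⊕-absorbˡ y ⟩
    𝟙              ∎

  ¬≈𝟘⇔≈𝟙 : ∀ {x} → ¬ x ≈ 𝟘 ⇔ x ≈ 𝟙
  ¬≈𝟘⇔≈𝟙 {x} = mk⇔ (λ p → ≈-trans (≈-sym (¬¬ x)) (¬-cong p))
                   (λ p → ≈-trans (¬-cong p) ¬𝟙≈𝟘)

  ⊕≈𝟘⇔ : ∀ {x y} → x ⊕ y ≈ 𝟘 ⇔ (x ≈ 𝟘 × y ≈ 𝟘)
  ⊕≈𝟘⇔ {x} {y} = mk⇔ (λ p → left p , left (≈-trans (⊕-comm y x) p))
                     (λ (p , q) → ≈-trans (⊕-cong p q) (⊕-identityʳ 𝟘))
    where
    left : ∀ {u v} → u ⊕ v ≈ 𝟘 → u ≈ 𝟘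
    left {u} {v} p = ≈-trans (≈-sym (¬¬ u)) (Equivalence.from ¬≈𝟘⇔≈𝟙 (begin
      ¬ u            ≈⟨ ⊕-identityʳ _ ⟨
      ¬ u ⊕ 𝟘        ≈⟨ ⊕-congˡ p ⟨
      ¬ u ⊕ (u ⊕ v)  ≈⟨ ¬x⊕[x⊕y]≈𝟙 u v ⟩
      𝟙              ∎))

  infix 4 _≼_

  _≼_ : Rel Carrier (c ⊔ ℓ)
  x ≼ y = ∃[ w ] y ≈ x ⊕ w

  ≼-trans : ∀ {x y z} → x ≼ y → y ≼ z → x ≼ z
  ≼-trans {x} (w , p) (w′ , q) = w ⊕ w′ , ≈-trans q (≈-trans (⊕-congʳ p) (⊕-assoc x w w′))

  ≼-respʳ-≈ : ∀ {x y y′} → y ≈ y′ → x ≼ y → x ≼ y′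
  ≼-respʳ-≈ p (w , q) = w , ≈-trans (≈-sym p) q

  ≼-respˡ-≈ : ∀ {x x′ y} → x ≈ x′ → x ≼ y → x′ ≼ y
  ≼-respˡ-≈ p (w , q) = w , ≈-trans q (⊕-congʳ p)

  y≼x⊕y : ∀ x y → y ≼ x ⊕ y
  y≼x⊕y x y = x , ⊕-comm x y

  ⊕-monoʳ-≼ : ∀ z {x y} → x ≼ y → z ⊕ x ≼ z ⊕ y
  ⊕-monoʳ-≼ z {x} (w , p) = w , ≈-trans (⊕-congˡ p) (≈-sym (⊕-assoc z x w))

  ¬-antitone : ∀ {x y} → x ≼ y → ¬ y ≼ ¬ x
  ¬-antitone {x} {y} (w , p) = ¬ (¬ ¬ x ⊕ ¬ y) , ≈-sym (begin
    ¬ y ⊕ ¬ (¬ ¬ x ⊕ ¬ y)    ≈⟨ ⊕-comm _ _ ⟩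
    ¬ (¬ ¬ x ⊕ ¬ y) ⊕ ¬ y    ≈⟨ łuk (¬ x) (¬ y) ⟩
    ¬ (¬ ¬ y ⊕ ¬ x) ⊕ ¬ x    ≈⟨ ⊕-congʳ (¬-cong ¬¬y⊕¬x≈𝟙) ⟩
    ¬ 𝟙 ⊕ ¬ x                ≈⟨ ⊕-congʳ ¬𝟙≈𝟘 ⟩
    𝟘 ⊕ ¬ x                  ≈⟨ ⊕-identityˡ _ ⟩
    ¬ x                      ∎)
    where
    ¬¬y⊕¬x≈𝟙 : ¬ ¬ y ⊕ ¬ x ≈ 𝟙
    ¬¬y⊕¬x≈𝟙 = begin
      ¬ ¬ y ⊕ ¬ x      ≈⟨ ⊕-congʳ (≈-trans (¬¬ y) p) ⟩
      (x ⊕ w) ⊕ ¬ x    ≈⟨ ⊕-comm _ _ ⟩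
      ¬ x ⊕ (x ⊕ w)    ≈⟨ ¬x⊕[x⊕y]≈𝟙 x w ⟩
      𝟙                ∎

  ⊙-monoʳ-≼ : ∀ z {x y} → x ≼ y → z ⊙ x ≼ z ⊙ y
  ⊙-monoʳ-≼ z p = ¬-antitone (⊕-monoʳ-≼ (¬ z) (¬-antitone p))

  ⊥-sym : ∀ {x y} → x ⊥ y → y ⊥ x
  ⊥-sym {x} {y} p = ≈-trans (¬-cong (⊕-comm (¬ y) (¬ x))) p

  ⊥-respˡ : ∀ {x x′ y} → x ≈ x′ → x ⊥ y → x′ ⊥ y
  ⊥-respˡ p q = ≈-trans (¬-cong (⊕-congʳ (¬-cong (≈-sym p)))) q

  ⊥-respʳ : ∀ {x y y′} → y ≈ y′ → x ⊥ y → x ⊥ y′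
  ⊥-respʳ p q = ⊥-sym (⊥-respˡ p (⊥-sym q))

  𝟘⊥ : ∀ x → 𝟘 ⊥ x
  𝟘⊥ x = ≈-trans (¬-cong (⊕-absorbˡ (¬ x))) ¬𝟙≈𝟘

  ≼¬⇒⊥ : ∀ {x y} → x ≼ ¬ y → x ⊥ y
  ≼¬⇒⊥ {x} {y} (w , p) = begin
    ¬ (¬ x ⊕ ¬ y)         ≈⟨ ¬-cong (⊕-congˡ p) ⟩
    ¬ (¬ x ⊕ (x ⊕ w))     ≈⟨ ¬-cong (¬x⊕[x⊕y]≈𝟙 x w) ⟩
    ¬ 𝟙                   ≈⟨ ¬𝟙≈𝟘 ⟩
    𝟘                     ∎

  ⊥⇒≼¬ : ∀ {x y} → x ⊥ y → x ≼ ¬ y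
  ⊥⇒≼¬ {x} {y} p = ¬ (x ⊕ y) , ≈-sym (begin
    x ⊕ ¬ (x ⊕ y)           ≈⟨ ⊕-comm _ _ ⟩
    ¬ (x ⊕ y) ⊕ x           ≈⟨ ⊕-congʳ (¬-cong (⊕-comm x y)) ⟩
    ¬ (y ⊕ x) ⊕ x           ≈⟨ ⊕-congʳ (¬-cong (⊕-congʳ (¬¬ y))) ⟨
    ¬ (¬ ¬ y ⊕ x) ⊕ x       ≈⟨ łuk (¬ y) x ⟩
    x ⊙ y ⊕ ¬ y             ≈⟨ ⊕-congʳ p ⟩
    𝟘 ⊕ ¬ y                 ≈⟨ ⊕-identityˡ _ ⟩
    ¬ y                     ∎)

  ¬x⊙[x⊕y]≈y : ∀ {x y} → x ⊥ y → ¬ x ⊙ (x ⊕ y) ≈ y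
  ¬x⊙[x⊕y]≈y {x} {y} p = begin
    ¬ (¬ ¬ x ⊕ ¬ (x ⊕ y))  ≈⟨ ¬-cong (⊕-congʳ (¬¬ x)) ⟩
    ¬ (x ⊕ ¬ (x ⊕ y))      ≈⟨ ¬-cong (proj₂ (⊥⇒≼¬ p)) ⟨
    ¬ ¬ y                  ≈⟨ ¬¬ y ⟩
    y                      ∎

  ⊥-antitoneˡ : ∀ {x x′ y} → x′ ≼ x → x ⊥ y → x′ ⊥ y
  ⊥-antitoneˡ p q = ≼¬⇒⊥ (≼-trans p (⊥⇒≼¬ q))

  -- Both sides say that x + y + z is defined in ΞM.
  ⊥-assoc : ∀ {x y z} → (x ⊥ y × (x ⊕ y) ⊥ z) ⇔ (y ⊥ z × x ⊥ (y ⊕ z))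
  ⊥-assoc = mk⇔ forward backward
    where
    forward : ∀ {x y z} → x ⊥ y × (x ⊕ y) ⊥ z → y ⊥ z × x ⊥ (y ⊕ z)
    forward {x} {y} {z} (p , q) = ⊥-antitoneˡ (y≼x⊕y x y) q , ≼¬⇒⊥ x≼¬[y⊕z]
      where
      x≼¬[y⊕z] : x ≼ ¬ (y ⊕ z)
      x≼¬[y⊕z] = ≼-respʳ-≈ (¬-cong (⊕-cong (¬¬ y) (¬¬ z)))
                   (≼-respˡ-≈ (¬x⊙[x⊕y]≈y (⊥-sym p))
                     (⊙-monoʳ-≼ (¬ y) (⊥⇒≼¬ (⊥-respˡ (⊕-comm x y) q))))

    backward : ∀ {x y z} → y ⊥ z × x ⊥ (y ⊕ z) → x ⊥ y × (x ⊕ y) ⊥ z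
    backward {x} {y} {z} (p , q) =
      let (y⊥x , z⊥[y⊕x]) = forward (⊥-sym p , ⊥-respˡ (⊕-comm y z) (⊥-sym q))
      in ⊥-sym y⊥x , ⊥-respˡ (⊕-comm y x) (⊥-sym z⊥[y⊕x])

  ⊥-exchange : ∀ {x y z} → y ⊥ z → x ⊥ (y ⊕ z) → x ⊥ z × y ⊥ (x ⊕ z)
  ⊥-exchange p q =
    let (x⊥y , [x⊕y]⊥z) = Equivalence.from ⊥-assoc (p , q)
    in Equivalence.to ⊥-assoc (⊥-sym x⊥y , ⊥-respˡ (⊕-comm _ _) [x⊕y]⊥z)

  x⊥x⇒x⊕x≈x⇒x≈𝟘 : ∀ {x} → x ⊥ x → x ⊕ x ≈ x → x ≈ 𝟘
  x⊥x⇒x⊕x≈x⇒x≈𝟘 {x} p q = begin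
    x                      ≈⟨ ¬x⊙[x⊕y]≈y p ⟨
    ¬ (¬ ¬ x ⊕ ¬ (x ⊕ x))  ≈⟨ ¬-cong (⊕-cong (¬¬ x) (¬-cong q)) ⟩
    ¬ (x ⊕ ¬ x)            ≈⟨ ¬-cong (x⊕¬x≈𝟙 x) ⟩
    ¬ 𝟙                    ≈⟨ ¬𝟙≈𝟘 ⟩
    𝟘                      ∎

  ⊕-isCommutativeMonoid : IsCommutativeMonoid _≈_ _⊕_ 𝟘
  ⊕-isCommutativeMonoid = record
    { isMonoid = record
      { isSemigroup = record
        { isMagma = record { isEquivalence = isEquivalence ; ∙-cong = ⊕-cong }
        ; assoc = ⊕-assoc
        }
      ; identity = ⊕-identityˡ , ⊕-identityʳ
      }
    ; comm = ⊕-comm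
    }

  ⨁-++ : ∀ xs ys → ⨁ (xs ++ ys) ≈ ⨁ xs ⊕ ⨁ ys
  ⨁-++ []       ys = ≈-sym (⊕-identityˡ _)
  ⨁-++ (x ∷ xs) ys = ≈-trans (⊕-congˡ (⨁-++ xs ys)) (≈-sym (⊕-assoc _ _ _))

  ⨁-↭ : ∀ {xs ys} → xs ↭ ys → ⨁ xs ≈ ⨁ ys
  ⨁-↭ p = SetoidPermutation.foldr-commMonoid setoid ⊕-isCommutativeMonoid
            (↭⇒↭ₛ′ isEquivalence p)

  Summable-↭ : ∀ {xs ys} → xs ↭ ys → Summable xs → Summable ys
  Summable-↭ ↭.refl           s              = s
  Summable-↭ (↭.prep x p)     (o ∷ s)        = ⊥-respʳ (⨁-↭ p) o ∷ Summable-↭ p s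
  Summable-↭ (↭.swap x y p)   (o ∷ o′ ∷ s)   =
    let (x⊥rest , y⊥x⊕rest) = ⊥-exchange o′ o
    in ⊥-respʳ (⊕-congˡ (⨁-↭ p)) y⊥x⊕rest ∷ ⊥-respʳ (⨁-↭ p) x⊥rest ∷ Summable-↭ p s
  Summable-↭ (↭.trans p q)    s              = Summable-↭ q (Summable-↭ p s)

  Summable-++⁻ : ∀ xs {ys} → Summable (xs ++ ys) → Summable xs × Summable ys × ⨁ xs ⊥ ⨁ ys
  Summable-++⁻ []       s       = [] , s , 𝟘⊥ _
  Summable-++⁻ (x ∷ xs) (o ∷ s) =
    let (sxs , sys , xs⊥ys) = Summable-++⁻ xs s
        (x⊥xs , x⊕xs⊥ys)    = Equivalence.from ⊥-assoc (xs⊥ys , ⊥-respʳ (⨁-++ xs _) o)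
    in x⊥xs ∷ sxs , sys , x⊕xs⊥ys

  ⨁-map-cong : ∀ {a} {X : Set a} {f g : X → Carrier} → (∀ x → f x ≈ g x) →
               ∀ xs → ⨁ (map f xs) ≈ ⨁ (map g xs)
  ⨁-map-cong f≈g []       = ≈-refl
  ⨁-map-cong f≈g (x ∷ xs) = ⊕-cong (f≈g x) (⨁-map-cong f≈g xs)

  module _ {n} (f : Fin n → Carrier) where

    ⨁-copies-+ : ∀ c d → ⨁ (copies f (λ i → c i + d i)) ≈ ⨁ (copies f c) ⊕ ⨁ (copies f d)
    ⨁-copies-+ c d = ≈-trans (⨁-↭ (copies-+ f c d)) (⨁-++ (copies f c) _)

    Summable-copies-+⁻ : ∀ c d → Summable (copies f (λ i → c i + d i)) →
                           ⨁ (copies f c) ⊥ ⨁ (copies f d)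
    Summable-copies-+⁻ c d s =
      proj₂ (proj₂ (Summable-++⁻ (copies f c) (Summable-↭ (copies-+ f c d) s)))

    Summable-copies-≤ : ∀ {c d} → (∀ i → c i ≤ d i) → Summable (copies f d) → Summable (copies f c)
    Summable-copies-≤ {c} {d} c≤d s =
      proj₁ (Summable-++⁻ (copies f c) (Summable-↭ (copies-+ f c (λ i → d i ∸ c i)) s′))
      where
      s′ : Summable (copies f (λ i → c i + (d i ∸ c i)))
      s′ = ≡.subst (λ is → Summable (map f is)) (multiset-cong (λ i → ≡.sym (m+[n∸m]≡n (c≤d i)))) s

-- Homomorphisms and evaluation of terms

Hom-⨁ : ∀ {a ℓa c ℓ} {M : MVAlgebra a ℓa} {N : MVAlgebra c ℓ} (h : Hom M N) xs →
        MVAlgebra._≈_ N (Hom.map h (MVProperties.⨁ M xs)) (MVProperties.⨁ N (map (Hom.map h) xs))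
Hom-⨁ h []                = Hom.map-𝟘 h
Hom-⨁ {N = N} h (x ∷ xs)  =
  MVProperties.≈-trans N (Hom.map-⊕ h x _) (MVProperties.⊕-congˡ N (Hom-⨁ h xs))

module Evaluation {c ℓ} (N : MVAlgebra c ℓ) {n} (ρ : Fin n → MVAlgebra.Carrier N) where
  open MVProperties N

  ⟦_⟧ : Term n → Carrier
  ⟦ var i ⟧  = ρ i
  ⟦ 𝟘ₜ ⟧     = 𝟘
  ⟦ t ⊕ₜ u ⟧ = ⟦ t ⟧ ⊕ ⟦ u ⟧
  ⟦ ¬ₜ t ⟧   = ¬ ⟦ t ⟧

  module _ {R : Term n → Term n → Set} where

    ⟦⟧-cong : (∀ {t u} → R t u → ⟦ t ⟧ ≈ ⟦ u ⟧) → ∀ {t u} → R ⊢ t ≈ₜ u → ⟦ t ⟧ ≈ ⟦ u ⟧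
    ⟦⟧-cong ⟦R⟧ (≈ₜ.rel r)         = ⟦R⟧ r
    ⟦⟧-cong ⟦R⟧ ≈ₜ.refl            = ≈-refl
    ⟦⟧-cong ⟦R⟧ (≈ₜ.sym p)         = ≈-sym (⟦⟧-cong ⟦R⟧ p)
    ⟦⟧-cong ⟦R⟧ (≈ₜ.trans p q)     = ≈-trans (⟦⟧-cong ⟦R⟧ p) (⟦⟧-cong ⟦R⟧ q)
    ⟦⟧-cong ⟦R⟧ (≈ₜ.⊕-cong p q)    = ⊕-cong (⟦⟧-cong ⟦R⟧ p) (⟦⟧-cong ⟦R⟧ q)
    ⟦⟧-cong ⟦R⟧ (≈ₜ.¬-cong p)      = ¬-cong (⟦⟧-cong ⟦R⟧ p)
    ⟦⟧-cong ⟦R⟧ (≈ₜ.assoc x y z)   = ⊕-assoc _ _ _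
    ⟦⟧-cong ⟦R⟧ (≈ₜ.comm x y)      = ⊕-comm _ _
    ⟦⟧-cong ⟦R⟧ (≈ₜ.idʳ x)         = ⊕-identityʳ _
    ⟦⟧-cong ⟦R⟧ (≈ₜ.¬¬ x)          = ¬¬ _
    ⟦⟧-cong ⟦R⟧ (≈ₜ.absorb x)      = ⊕-absorb _
    ⟦⟧-cong ⟦R⟧ (≈ₜ.łuk x y)       = łuk _ _

    evalHom : (∀ {t u} → R t u → ⟦ t ⟧ ≈ ⟦ u ⟧) → Hom (Presented n R) N
    evalHom ⟦R⟧ = record
      { map      = ⟦_⟧
      ; map-cong = ⟦⟧-cong ⟦R⟧
      ; map-⊕    = λ _ _ → ≈-refl
      ; map-¬    = λ _ → ≈-refl
      ; map-𝟘    = ≈-refl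
      }

    Hom-unique : (h : Hom (Presented n R) N) → (∀ i → Hom.map h (var i) ≈ ρ i) →
                 ∀ t → Hom.map h t ≈ ⟦ t ⟧
    Hom-unique h h≈ρ (var i)  = h≈ρ i
    Hom-unique h h≈ρ 𝟘ₜ       = Hom.map-𝟘 h
    Hom-unique h h≈ρ (t ⊕ₜ u) =
      ≈-trans (Hom.map-⊕ h t u) (⊕-cong (Hom-unique h h≈ρ t) (Hom-unique h h≈ρ u))
    Hom-unique h h≈ρ (¬ₜ t)   = ≈-trans (Hom.map-¬ h t) (¬-cong (Hom-unique h h≈ρ t))

  ⟦foldl⟧ : ∀ p ts → ⟦ foldl _⊕ₜ_ p ts ⟧ ≈ ⟦ p ⟧ ⊕ ⨁ (map ⟦_⟧ ts)
  ⟦foldl⟧ p []       = ≈-sym (⊕-identityʳ _)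
  ⟦foldl⟧ p (t ∷ ts) = ≈-trans (⟦foldl⟧ (p ⊕ₜ t) ts) (⊕-assoc _ _ _)

  ⟦overlaps⟧≈𝟘⇔ : ∀ p ts →
                  ⟦ overlaps p ts ⟧ ≈ 𝟘 ⇔ (Summable (map ⟦_⟧ ts) × ⟦ p ⟧ ⊥ ⨁ (map ⟦_⟧ ts))
  ⟦overlaps⟧≈𝟘⇔ p []       = mk⇔ (λ _ → [] , ⊥-sym (𝟘⊥ _)) (λ _ → ≈-refl)
  ⟦overlaps⟧≈𝟘⇔ p (t ∷ ts) = mk⇔ to from
    where
    IH : ⟦ overlaps (p ⊕ₜ t) ts ⟧ ≈ 𝟘 ⇔
         (Summable (map ⟦_⟧ ts) × ⟦ p ⊕ₜ t ⟧ ⊥ ⨁ (map ⟦_⟧ ts))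
    IH = ⟦overlaps⟧≈𝟘⇔ (p ⊕ₜ t) ts
    to : ⟦ overlaps p (t ∷ ts) ⟧ ≈ 𝟘 →
         Summable (map ⟦_⟧ (t ∷ ts)) × ⟦ p ⟧ ⊥ ⨁ (map ⟦_⟧ (t ∷ ts))
    to e =
      let (t⊥p , rest≈𝟘)     = Equivalence.to ⊕≈𝟘⇔ e
          (s , p⊕t⊥ts)        = Equivalence.to IH rest≈𝟘
          (t⊥ts , p⊥t⊕ts)     = Equivalence.to ⊥-assoc (⊥-sym t⊥p , p⊕t⊥ts)
      in t⊥ts ∷ s , p⊥t⊕ts
    from : Summable (map ⟦_⟧ (t ∷ ts)) × ⟦ p ⟧ ⊥ ⨁ (map ⟦_⟧ (t ∷ ts)) →
           ⟦ overlaps p (t ∷ ts) ⟧ ≈ 𝟘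
    from (t⊥ts ∷ s , p⊥t⊕ts) =
      let (p⊥t , p⊕t⊥ts) = Equivalence.from ⊥-assoc (t⊥ts , p⊥t⊕ts)
      in Equivalence.from ⊕≈𝟘⇔ (⊥-sym p⊥t , Equivalence.from IH (s , p⊕t⊥ts))

  map-⟦summands⟧ : ∀ k → map ⟦_⟧ (summands n k) ≡ copies ρ k
  map-⟦summands⟧ k =
    ≡.trans (cong (map ⟦_⟧) (≡.sym (copies-concatMap var k))) (≡.sym (map-∘ (multiset k)))

  ⟦σ⟧≈𝟘⇔ : ∀ k → ⟦ σ n k ⟧ ≈ 𝟘 ⇔ PartitionOfUnity (copies ρ k)
  ⟦σ⟧≈𝟘⇔ k =
    ≡.subst (λ xs → ⟦ σ n k ⟧ ≈ 𝟘 ⇔ PartitionOfUnity xs) (map-⟦summands⟧ k) (mk⇔ to from)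
    where
    ts : List (Term n)
    ts = summands n k
    ⟦⨁ₜ⟧≈⨁ : ⟦ ⨁ₜ ts ⟧ ≈ ⨁ (map ⟦_⟧ ts)
    ⟦⨁ₜ⟧≈⨁ = ≈-trans (⟦foldl⟧ 𝟘ₜ ts) (⊕-identityˡ _)
    to : ⟦ σ n k ⟧ ≈ 𝟘 → PartitionOfUnity (map ⟦_⟧ ts)
    to e =
      let (¬sum≈𝟘 , overlaps≈𝟘) = Equivalence.to ⊕≈𝟘⇔ e
      in proj₁ (Equivalence.to (⟦overlaps⟧≈𝟘⇔ 𝟘ₜ ts) overlaps≈𝟘) ,
         ≈-trans (≈-sym ⟦⨁ₜ⟧≈⨁) (Equivalence.to ¬≈𝟘⇔≈𝟙 ¬sum≈𝟘)
    from : PartitionOfUnity (map ⟦_⟧ ts) → ⟦ σ n k ⟧ ≈ 𝟘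
    from (s , sum≈𝟙) = Equivalence.from ⊕≈𝟘⇔
      ( Equivalence.from ¬≈𝟘⇔≈𝟙 (≈-trans ⟦⨁ₜ⟧≈⨁ sum≈𝟙)
      , Equivalence.from (⟦overlaps⟧≈𝟘⇔ 𝟘ₜ ts) (s , 𝟘⊥ _) )

⟦⟧-var : ∀ {n R} (t : Term n) → Evaluation.⟦_⟧ (Presented n R) var t ≡ t
⟦⟧-var (var i)  = ≡.refl
⟦⟧-var 𝟘ₜ       = ≡.refl
⟦⟧-var (t ⊕ₜ u) = cong₂ _⊕ₜ_ (⟦⟧-var t) (⟦⟧-var u)
⟦⟧-var (¬ₜ t)   = cong ¬ₜ_ (⟦⟧-var t)

-- The product A, its states, and the universal state

module Product {n : ℕ} (k : Fin n → ℕ) where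
  open FiniteSums (A n k)

  ⌊_⌋ : Carrier → Fin n → ℕ
  ⌊ a ⌋ i = toℕ (a i)

  ⌊𝟙⌋ : ⌊ 𝟙 ⌋ ≗ k
  ⌊𝟙⌋ i = opposite-prop fzero

  ⊙≈𝟘⇔ : ∀ a b → a ⊙ b ≈ 𝟘 ⇔ (∀ i → ⌊ a ⌋ i + ⌊ b ⌋ i ≤ k i)
  ⊙≈𝟘⇔ a b = mk⇔ (λ e i → Equivalence.to (⊙ₘ≡0⇔ (a i) (b i)) (e i))
                 (λ le i → Equivalence.from (⊙ₘ≡0⇔ (a i) (b i)) (le i))

  ⌊⊕⌋ : ∀ a b → a ⊙ b ≈ 𝟘 → ∀ i → ⌊ a ⊕ b ⌋ i ≡ ⌊ a ⌋ i + ⌊ b ⌋ i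
  ⌊⊕⌋ a b e i = toℕ-⊕ₘ-≤ (a i) (b i) (Equivalence.to (⊙≈𝟘⇔ a b) e i)

  coordinateSum : Fin n → List Carrier → ℕ
  coordinateSum j xs = sum (map (λ x → ⌊ x ⌋ j) xs)

  Summable-coordinatewise : ∀ xs → (∀ j → coordinateSum j xs ≤ k j) →
                            Summable xs × (∀ j → ⌊ ⨁ xs ⌋ j ≡ coordinateSum j xs)
  Summable-coordinatewise []       _   = [] , λ _ → ≡.refl
  Summable-coordinatewise (x ∷ xs) x+xs≤k =
    Equivalence.from (⊙≈𝟘⇔ x (⨁ xs)) x+⨁xs≤k ∷ proj₁ IH ,
    λ j → ≡.trans (toℕ-⊕ₘ-≤ (x j) (⨁ xs j) (x+⨁xs≤k j)) (cong (⌊ x ⌋ j +_) (proj₂ IH j))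
    where
    IH : Summable xs × (∀ j → ⌊ ⨁ xs ⌋ j ≡ coordinateSum j xs)
    IH = Summable-coordinatewise xs (λ j → m+n≤o⇒n≤o (⌊ x ⌋ j) (x+xs≤k j))
    x+⨁xs≤k : ∀ j → ⌊ x ⌋ j + ⌊ ⨁ xs ⌋ j ≤ k j
    x+⨁xs≤k j = ≡.subst (λ m → ⌊ x ⌋ j + m ≤ k j) (≡.sym (proj₂ IH j)) (x+xs≤k j)

  module _ (hk : ∀ i → 1 ≤ k i) where
    private
      atom′ : Fin n → Carrier
      atom′ = atom n k hk

    ⌊atom⌋-diag : ∀ i → ⌊ atom′ i ⌋ i ≡ 1
    ⌊atom⌋-diag i with i ≟ i
    ... | yes _   = toℕ-fromℕ< (s≤s (hk i))
    ... | no i≢i  = contradiction ≡.refl i≢i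

    ⌊atom⌋-off : ∀ i j → j ≢ i → ⌊ atom′ i ⌋ j ≡ 0
    ⌊atom⌋-off i j j≢i with j ≟ i
    ... | yes j≡i = contradiction j≡i j≢i
    ... | no _    = ≡.refl

    multiset-⌊atom⌋ : ∀ i → multiset ⌊ atom′ i ⌋ ≡ i ∷ []
    multiset-⌊atom⌋ i = ≡.trans (multiset-single ⌊ atom′ i ⌋ i (⌊atom⌋-off i))
                                (cong (λ m → replicate m i) (⌊atom⌋-diag i))

    coordinateSum-atoms : ∀ c j → coordinateSum j (copies atom′ c) ≡ c j
    coordinateSum-atoms c j = begin
      sum (map (λ x → ⌊ x ⌋ j) (copies atom′ c))   ≡⟨ cong sum (map-∘ (multiset c)) ⟨
      sum (copies (λ i → ⌊ atom′ i ⌋ j) c)         ≡⟨ sum-copies (λ i → ⌊ atom′ i ⌋ j) c ⟩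
      sum (tabulate (λ i → c i * ⌊ atom′ i ⌋ j))   ≡⟨ sum-tabulate-single _ j off-diagonal ⟩
      c j * ⌊ atom′ j ⌋ j                          ≡⟨ cong (c j *_) (⌊atom⌋-diag j) ⟩
      c j * 1                                      ≡⟨ *-identityʳ (c j) ⟩
      c j                                          ∎
      where
      open ≡.≡-Reasoning
      off-diagonal : ∀ i → i ≢ j → c i * ⌊ atom′ i ⌋ j ≡ 0
      off-diagonal i i≢j = ≡.trans (cong (c i *_) (⌊atom⌋-off i j (i≢j ∘ ≡.sym))) (*-zeroʳ (c i))

    atom-decomposition : ∀ a → Summable (copies atom′ ⌊ a ⌋) × a ≈ ⨁ (copies atom′ ⌊ a ⌋)
    atom-decomposition a =
      proj₁ sum-of-atoms ,
      λ j → toℕ-injective (≡.sym (≡.trans (proj₂ sum-of-atoms j) (coordinateSum-atoms ⌊ a ⌋ j)))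
      where
      sum-of-atoms : Summable (copies atom′ ⌊ a ⌋) ×
                     (∀ j → ⌊ ⨁ (copies atom′ ⌊ a ⌋) ⌋ j ≡ coordinateSum j (copies atom′ ⌊ a ⌋))
      sum-of-atoms = Summable-coordinatewise (copies atom′ ⌊ a ⌋)
        (λ j → ≡.subst (_≤ k j) (≡.sym (coordinateSum-atoms ⌊ a ⌋ j)) (toℕ≤pred[n] (a j)))

module StateProperties {c ℓ} {n} {k : Fin n → ℕ} (hk : ∀ i → 1 ≤ k i)
                       {N : MVAlgebra c ℓ} (s : State (A n k) N) where
  open MVProperties N
  private
    module Aₖ = FiniteSums (A n k)
    open Product k

    s[_] : Aₖ.Carrier → Carrier
    s[_] = State.map s

    atom′ : Fin n → Aₖ.Carrier
    atom′ = atom n k hk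

  state-𝟘 : s[ Aₖ.𝟘 ] ≈ 𝟘
  state-𝟘 =
    let (s𝟘⊥s𝟘 , s[𝟘⊕𝟘]≈s𝟘⊕s𝟘) =
          State.additive s Aₖ.𝟘 Aₖ.𝟘 (Equivalence.from (⊙≈𝟘⇔ Aₖ.𝟘 Aₖ.𝟘) λ _ → z≤n)
    in x⊥x⇒x⊕x≈x⇒x≈𝟘 s𝟘⊥s𝟘 (≈-trans (≈-sym s[𝟘⊕𝟘]≈s𝟘⊕s𝟘) (State.map-cong s λ _ → ≡.refl))

  state-⨁ : ∀ {xs} → Aₖ.Summable xs → Summable (map s[_] xs) × s[ Aₖ.⨁ xs ] ≈ ⨁ (map s[_] xs)
  state-⨁ []                  = [] , state-𝟘
  state-⨁ {x ∷ xs} (o ∷ sxs) =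
    let (s-sxs , s⨁≈⨁s) = state-⨁ sxs
        (sx⊥s⨁ , s[x⊕⨁]≈) = State.additive s x (Aₖ.⨁ xs) o
    in ⊥-respʳ s⨁≈⨁s sx⊥s⨁ ∷ s-sxs , ≈-trans s[x⊕⨁]≈ (⊕-congˡ s⨁≈⨁s)

  state-decomposition : ∀ a → Summable (copies (s[_] ∘ atom′) ⌊ a ⌋) ×
                              s[ a ] ≈ ⨁ (copies (s[_] ∘ atom′) ⌊ a ⌋)
  state-decomposition a =
    ≡.subst (λ ys → Summable ys × s[ a ] ≈ ⨁ ys) (≡.sym (map-∘ (multiset ⌊ a ⌋)))
    (let (atoms-summable , a≈⨁atoms) = atom-decomposition hk a
         (s-summable , s⨁≈⨁s)       = state-⨁ atoms-summable
     in s-summable , ≈-trans (State.map-cong s a≈⨁atoms) s⨁≈⨁s)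

  state-partitionOfUnity : PartitionOfUnity (copies (s[_] ∘ atom′) k)
  state-partitionOfUnity =
    ≡.subst (λ is → PartitionOfUnity (map (s[_] ∘ atom′) is)) (multiset-cong ⌊𝟙⌋)
    (let (summable , s𝟙≈⨁) = state-decomposition Aₖ.𝟙
     in summable , ≈-trans (≈-sym s𝟙≈⨁) (State.map-𝟙 s))

module UniversalState (n : ℕ) (k : Fin n → ℕ) (hk : ∀ i → 1 ≤ k i) where
  open MVProperties (S n k)
  open Product k
  private
    atom′ : Fin n → MVSig.Carrier (A n k)
    atom′ = atom n k hk

  var-partitionOfUnity : PartitionOfUnity (copies var k)
  var-partitionOfUnity = Equivalence.to (Evaluation.⟦σ⟧≈𝟘⇔ (S n k) var k)
                           (≡.subst (_≈ 𝟘) (≡.sym (⟦⟧-var (σ n k))) (≈ₜ.rel σ≈0))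

  linearCombination : (Fin n → ℕ) → Term n
  linearCombination c = ⨁ (copies var c)

  linearCombination-cong : ∀ {c d} → c ≗ d → linearCombination c ≈ linearCombination d
  linearCombination-cong c≗d = ≈-reflexive (cong (λ is → ⨁ (map var is)) (multiset-cong c≗d))

  υ-map : MVSig.Carrier (A n k) → Term n
  υ-map a = linearCombination ⌊ a ⌋

  υ : State (A n k) (S n k)
  υ = record
    { map      = υ-map
    ; map-cong = λ a≈b → linearCombination-cong (λ i → cong toℕ (a≈b i))
    ; map-𝟙    = ≈-trans (linearCombination-cong ⌊𝟙⌋) (proj₂ var-partitionOfUnity)
    ; additive = λ a b a⊙b≈𝟘 →
        Summable-copies-+⁻ var ⌊ a ⌋ ⌊ b ⌋
          (Summable-copies-≤ var (Equivalence.to (⊙≈𝟘⇔ a b) a⊙b≈𝟘) (proj₁ var-partitionOfUnity)) ,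
        ≈-trans (linearCombination-cong (⌊⊕⌋ a b a⊙b≈𝟘)) (⨁-copies-+ var ⌊ a ⌋ ⌊ b ⌋)
    }

  υ-atom : ∀ i → υ-map (atom′ i) ≈ var i
  υ-atom i =
    ≈-trans (≈-reflexive (cong (λ is → ⨁ (map var is)) (multiset-⌊atom⌋ hk i))) (⊕-identityʳ (var i))

  υ-unique : ∀ (υ′ : State (A n k) (S n k)) → (∀ i → State.map υ′ (atom′ i) ≈ var i) →
             ∀ a → State.map υ′ a ≈ υ-map a
  υ-unique υ′ υ′-atom a = ≈-trans (proj₂ (StateProperties.state-decomposition hk υ′ a))
                                  (⨁-map-cong υ′-atom (multiset ⌊ a ⌋))

  module _ {c ℓ} (N : MVAlgebra c ℓ) (s : State (A n k) N) where
    private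
      module N = MVProperties N
      open Evaluation N (State.map s ∘ atom′)
      open StateProperties hk s

    induced : Hom (S n k) N
    induced = evalHom λ { σ≈0 → Equivalence.from (⟦σ⟧≈𝟘⇔ k) state-partitionOfUnity }

    induced∘υ≈s : ∀ a → Hom.map induced (υ-map a) N.≈ State.map s a
    induced∘υ≈s a = N.≈-trans (Hom-⨁ induced (copies var ⌊ a ⌋))
                      (N.≈-trans (N.≈-reflexive (cong N.⨁ (≡.sym (map-∘ (multiset ⌊ a ⌋)))))
                                 (N.≈-sym (proj₂ (state-decomposition a))))

    induced-unique : ∀ (h′ : Hom (S n k) N) → (∀ a → Hom.map h′ (υ-map a) N.≈ State.map s a) →
                     ∀ t → Hom.map h′ t N.≈ Hom.map induced t
    induced-unique h′ h′∘υ≈s = Hom-unique h′ λ i →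
      N.≈-trans (Hom.map-cong h′ (≈ₜ.sym (υ-atom i))) (h′∘υ≈s (atom′ i))

lemma6p3 : (n : ℕ) (k : Fin n → ℕ) (hk : ∀ i → 1 ≤ k i) →
    Σω (State (A n k) (S n k)) λ υ →
      ( (∀ i → σRel n k ⊢ State.map υ (atom n k hk i) ≈ₜ var i)
      × (∀ (υ′ : State (A n k) (S n k)) →
           (∀ i → σRel n k ⊢ State.map υ′ (atom n k hk i) ≈ₜ var i) →
           ∀ a → σRel n k ⊢ State.map υ′ a ≈ₜ State.map υ a) )
      ×ω
      (∀ {c ℓ : Level} (N : MVAlgebra c ℓ) (s : State (A n k) N) →
         Σ (Hom (S n k) N) λ h →
           (∀ a → MVAlgebra._≈_ N (Hom.map h (State.map υ a)) (State.map s a))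
         × (∀ (h′ : Hom (S n k) N) →
              (∀ a → MVAlgebra._≈_ N (Hom.map h′ (State.map υ a)) (State.map s a)) →
              ∀ t → MVAlgebra._≈_ N (Hom.map h′ t) (Hom.map h t)))
lemma6p3 n k hk =
  υ ,ω ((υ-atom , υ-unique) ,ω λ N s → induced N s , induced∘υ≈s N s , induced-unique N s)
  where open UniversalState n k hk
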